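{- Let $R \in \mathcal{P}$ be a reachable RMPC process in which the parallel composition operator does not occur. Then the underlying CTMC $\mathcal{M}[\![R]\!]$ is a tree-like birth-death process.
   Context: RMPC. Fix a countable set $\mathcal{A}$ of actions, rates in $\mathbb{R}_{>0}$, and a countable set $\mathcal{K}$ of keys. Forward processes: $P,Q ::= \mathbf{0} \mid \langle a,\lambda\rangle.P \mid P+Q \mid P\parallel_L Q$ ($L\subseteq\mathcal A$); reversible processes: $R,S ::= P \mid \langle a,\lambda\rangle[i].R \mid R+S \mid R\parallel_L S$ ($i\in\mathcal K$). $\mathrm{std}(R)$ means $R$ is a forward process; $\mathrm{key}(R)$ is the set of keys occurring in $R$. Every rate $\lambda$ has an associated backward rate $\overline{\lambda}>0$. Forward $\to$ and backward $\rightsquigarrow$ transition relations are the least relations closed under (symmetric variants of Cho, Par, Cho$^r$, Par$^r$ included): (Act1) if $\mathrm{std}(R)$ then $\langle a,\lambda\rangle.R \xrightarrow{\langle a,\lambda\rangle[i]} \langle a,\lambda\rangle[i].R$ for every $i\in\mathcal K$; (Act1$^r$) if $\mathrm{std}(R)$ then $\langle a,\lambda\rangle[i].R \rightsquigarrow^{\langle a,\overline\lambda\rangle[i]} \langle a,\lambda\rangle.R$. (Act2) if $R\xrightarrow{\langle b,\mu\rangle[j]}R'$ and $j\neq i$ then $\langle a,\lambda\rangle[i].R\xrightarrow{\langle b,\mu\rangle[j]}\langle a,\lambda\rangle[i].R'$; (Act2$^r$) the same with $\rightsquigarrow$ and label $\langle b,\overline\mu\rangle[j]$. (Cho) if $R\xrightarrow{\ell}R'$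 and $\mathrm{std}(S)$ then $R+S\xrightarrow{\ell}R'+S$; (Cho$^r$) the same with $\rightsquigarrow$. (Par) if $R\xrightarrow{\langle a,\lambda\rangle[i]}R'$, $a\notin L$, $i\notin\mathrm{key}(S)$ then $R\parallel_L S\xrightarrow{\langle a,\lambda\rangle[i]}R'\parallel_L S$; (Par$^r$) the same with $\rightsquigarrow$. (Coo) if $R\xrightarrow{\langle a,\lambda\rangle[i]}R'$, $S\xrightarrow{\langle a,\mu\rangle[i]}S'$, $a\in L$ then $R\parallel_L S\xrightarrow{\langle a,\lambda\cdot\mu\rangle[i]}R'\parallel_L S'$; (Coo$^r$) if $R\rightsquigarrow^{\langle a,\overline\lambda\rangle[i]}R'$, $S\rightsquigarrow^{\langle a,\overline\mu\rangle[i]}S'$, $a\in L$ then $R\parallel_L S\rightsquigarrow^{\langle a,\overline\lambda\cdot\overline\mu\rangle[i]}R'\parallel_L S'$. $\mathcal P$ (reachable processes) = forward processes plus all processes obtained from them by finitely many forward transitions. Process contexts: $\mathcal C ::= \bullet \mid \langle a,\lambda\rangle[i].\mathcal C \mid R+\mathcal C \mid \mathcal C+R \mid R\parallel_L\mathcal C \mid \mathcal C\parallel_L R$. $\equiv_{\mathcal K}$ is the smallest equivalence relation on $\mathcal P$ such that: (i) if $\mathcal C$ contains no $\parallel_L$ with $a\in L$ and $i,j$ do not occur in $\mathcal C$ and $R$, then $\mathcal C[\langle a,\lambda\rangle[i].R]\equiv_{\mathcal K}\mathcal C[\langle a,\lambda\rangle[j].R]$; (ii) the analogous rule renaming simultaneously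 a key $i$ shared by synchronized prefixes $\langle a,\lambda_k\rangle[i]$ across parallel compositions $\parallel_{L_k}$ with $a\in L_k$ (irrelevant in the absence of parallel composition). The underlying CTMC $\mathcal M[\![R]\!]$ has as states the $\equiv_{\mathcal K}$-classes reachable from the initial state $[R]_{\equiv_{\mathcal K}}$, a forward transition $[S]\xrightarrow{\langle a,\lambda\rangle}[S']$ whenever $S\xrightarrow{\langle a,\lambda\rangle[i]}S'$ for some $i$, and a backward transition $[S]\rightsquigarrow^{\langle a,\overline\lambda\rangle}[S']$ whenever $S\rightsquigarrow^{\langle a,\overline\lambda\rangle[i]}S'$ for some $i$. It is a tree-like birth-death process if the directed graph whose vertices are its states and whose edges are its forward (birth) transitions is a tree rooted at the initial state (every non-initial state has exactly one incoming forward transition, from its parent, and the initial state has none), and the backward (death) transitions are exactly the reversals of the forward ones: every non-initial state has exactly one backward transition, leading to its parent, and the initial state has none. -}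

-- Rates are an arbitrary carrier
-- `Rate` with a backward-rate map `bar` and a multiplication `_·_`
-- (the paper's positive reals cannot be expressed).
-- A synchronisation set L ⊆ 𝒜 is given by its characteristic function.

module Defs where

open import Data.Nat using (ℕ)
open import Data.Bool using (Bool; true; false)
open import Data.Product using (Σ; _×_; _,_; ∃)
open import Relation.Binary.PropositionalEquality using (_≡_)
open import Relation.Nullary using (¬_)

module RMPC (Rate : Set) (bar : Rate → Rate) (_·_ : Rate → Rate → Rate) where

  Act : Set
  Act = ℕ

  Key : Set
  Key = ℕ

  ActSet : Set
  ActSet = Act → Bool

  -- reversible processes (forward processes are those with std)
  data Proc : Set where
    𝟎    : Proc
    pre  : Act → Rate → Proc → Proc
    kpre : Act → Rate → Key → Proc → Proc
    _⊕_  : Proc → Proc → Proc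
    par  : Proc → ActSet → Proc → Proc

  data Std : Proc → Set where
    std-nil : Std 𝟎
    std-pre : ∀ {a ρ P} → Std P → Std (pre a ρ P)
    std-sum : ∀ {P Q} → Std P → Std Q → Std (P ⊕ Q)
    std-par : ∀ {P Q L} → Std P → Std Q → Std (par P L Q)

  data KeyIn (i : Key) : Proc → Set where
    k-pre   : ∀ {a ρ P} → KeyIn i P → KeyIn i (pre a ρ P)
    k-here  : ∀ {a ρ R} → KeyIn i (kpre a ρ i R)
    k-there : ∀ {a ρ j R} → KeyIn i R → KeyIn i (kpre a ρ j R)
    k-sumˡ  : ∀ {R S} → KeyIn i R → KeyIn i (R ⊕ S)
    k-sumʳ  : ∀ {R S} → KeyIn i S → KeyIn i (R ⊕ S)
    k-parˡ  : ∀ {R S L} → KeyIn i R → KeyIn i (par R L S)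
    k-parʳ  : ∀ {R S L} → KeyIn i S → KeyIn i (par R L S)

  data NoPar : Proc → Set where
    np-nil  : NoPar 𝟎
    np-pre  : ∀ {a ρ P} → NoPar P → NoPar (pre a ρ P)
    np-kpre : ∀ {a ρ i R} → NoPar R → NoPar (kpre a ρ i R)
    np-sum  : ∀ {R S} → NoPar R → NoPar S → NoPar (R ⊕ S)

  data _—[_,_,_]→_ : Proc → Act → Rate → Key → Proc → Set where
    act1 : ∀ {a ρ R} i → Std R → pre a ρ R —[ a , ρ , i ]→ kpre a ρ i R
    act2 : ∀ {a ρ i b μ j R R'} → R —[ b , μ , j ]→ R' → ¬ (j ≡ i) →
           kpre a ρ i R —[ b , μ , j ]→ kpre a ρ i R'
    choˡ : ∀ {R R' S a ρ i} → R —[ a , ρ , i ]→ R' → Std S →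
           (R ⊕ S) —[ a , ρ , i ]→ (R' ⊕ S)
    choʳ : ∀ {R S S' a ρ i} → S —[ a , ρ , i ]→ S' → Std R →
           (R ⊕ S) —[ a , ρ , i ]→ (R ⊕ S')
    parˡ : ∀ {R R' S L a ρ i} → R —[ a , ρ , i ]→ R' → L a ≡ false →
           ¬ KeyIn i S → par R L S —[ a , ρ , i ]→ par R' L S
    parʳ : ∀ {R S S' L a ρ i} → S —[ a , ρ , i ]→ S' → L a ≡ false →
           ¬ KeyIn i R → par R L S —[ a , ρ , i ]→ par R L S'
    coo  : ∀ {R R' S S' L a ρ μ i} → R —[ a , ρ , i ]→ R' →
           S —[ a , μ , i ]→ S' → L a ≡ true →
           par R L S —[ a , ρ · μ , i ]→ par R' L S'

  data _⇝[_,_,_]_ : Proc → Act → Rate → Key → Proc → Set where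
    act1ʳ : ∀ {a ρ i R} → Std R → kpre a ρ i R ⇝[ a , bar ρ , i ] pre a ρ R
    act2ʳ : ∀ {a ρ i b ν j R R'} → R ⇝[ b , ν , j ] R' → ¬ (j ≡ i) →
            kpre a ρ i R ⇝[ b , ν , j ] kpre a ρ i R'
    choˡʳ : ∀ {R R' S a ν i} → R ⇝[ a , ν , i ] R' → Std S →
            (R ⊕ S) ⇝[ a , ν , i ] (R' ⊕ S)
    choʳʳ : ∀ {R S S' a ν i} → S ⇝[ a , ν , i ] S' → Std R →
            (R ⊕ S) ⇝[ a , ν , i ] (R ⊕ S')
    parˡʳ : ∀ {R R' S L a ν i} → R ⇝[ a , ν , i ] R' → L a ≡ false →
            ¬ KeyIn i S → par R L S ⇝[ a , ν , i ] par R' L S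
    parʳʳ : ∀ {R S S' L a ν i} → S ⇝[ a , ν , i ] S' → L a ≡ false →
            ¬ KeyIn i R → par R L S ⇝[ a , ν , i ] par R L S'
    cooʳ  : ∀ {R R' S S' L a ν₁ ν₂ i} → R ⇝[ a , ν₁ , i ] R' →
            S ⇝[ a , ν₂ , i ] S' → L a ≡ true →
            par R L S ⇝[ a , ν₁ · ν₂ , i ] par R' L S'

  data Reachable : Proc → Set where
    fwd  : ∀ {P} → Std P → Reachable P
    step : ∀ {R R' a ρ i} → Reachable R → R —[ a , ρ , i ]→ R' → Reachable R'

  data Ctx : Set where
    ●     : Ctx
    kpreC : Act → Rate → Key → Ctx → Ctx
    sumL  : Proc → Ctx → Ctx
    sumR  : Ctx → Proc → Ctx
    parL  : Proc → ActSet → Ctx → Ctx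
    parR  : Ctx → ActSet → Proc → Ctx

  plug : Ctx → Proc → Proc
  plug ●             X = X
  plug (kpreC a ρ i C) X = kpre a ρ i (plug C X)
  plug (sumL R C)    X = R ⊕ plug C X
  plug (sumR C R)    X = plug C X ⊕ R
  plug (parL R L C)  X = par R L (plug C X)
  plug (parR C L R)  X = par (plug C X) L R

  data SyncOn (a : Act) : Proc → Set where
    s-here  : ∀ {R S L} → L a ≡ true → SyncOn a (par R L S)
    s-parˡ  : ∀ {R S L} → SyncOn a R → SyncOn a (par R L S)
    s-parʳ  : ∀ {R S L} → SyncOn a S → SyncOn a (par R L S)
    s-pre   : ∀ {b ρ P} → SyncOn a P → SyncOn a (pre b ρ P)
    s-kpre  : ∀ {b ρ i R} → SyncOn a R → SyncOn a (kpre b ρ i R)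
    s-sumˡ  : ∀ {R S} → SyncOn a R → SyncOn a (R ⊕ S)
    s-sumʳ  : ∀ {R S} → SyncOn a S → SyncOn a (R ⊕ S)

  data SyncOnC (a : Act) : Ctx → Set where
    sc-parL-here : ∀ {R L C} → L a ≡ true → SyncOnC a (parL R L C)
    sc-parR-here : ∀ {R L C} → L a ≡ true → SyncOnC a (parR C L R)
    sc-parL-proc : ∀ {R L C} → SyncOn a R → SyncOnC a (parL R L C)
    sc-parR-proc : ∀ {R L C} → SyncOn a R → SyncOnC a (parR C L R)
    sc-parL-ctx  : ∀ {R L C} → SyncOnC a C → SyncOnC a (parL R L C)
    sc-parR-ctx  : ∀ {R L C} → SyncOnC a C → SyncOnC a (parR C L R)
    sc-kpre      : ∀ {b ρ i C} → SyncOnC a C → SyncOnC a (kpreC b ρ i C)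
    sc-sumL-proc : ∀ {R C} → SyncOn a R → SyncOnC a (sumL R C)
    sc-sumR-proc : ∀ {R C} → SyncOn a R → SyncOnC a (sumR C R)
    sc-sumL-ctx  : ∀ {R C} → SyncOnC a C → SyncOnC a (sumL R C)
    sc-sumR-ctx  : ∀ {R C} → SyncOnC a C → SyncOnC a (sumR C R)

  data KeyInC (i : Key) : Ctx → Set where
    kc-here    : ∀ {a ρ C} → KeyInC i (kpreC a ρ i C)
    kc-there   : ∀ {a ρ j C} → KeyInC i C → KeyInC i (kpreC a ρ j C)
    kc-sumL-p  : ∀ {R C} → KeyIn i R → KeyInC i (sumL R C)
    kc-sumL-c  : ∀ {R C} → KeyInC i C → KeyInC i (sumL R C)
    kc-sumR-p  : ∀ {R C} → KeyIn i R → KeyInC i (sumR C R)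
    kc-sumR-c  : ∀ {R C} → KeyInC i C → KeyInC i (sumR C R)
    kc-parL-p  : ∀ {R L C} → KeyIn i R → KeyInC i (parL R L C)
    kc-parL-c  : ∀ {R L C} → KeyInC i C → KeyInC i (parL R L C)
    kc-parR-p  : ∀ {R L C} → KeyIn i R → KeyInC i (parR C L R)
    kc-parR-c  : ∀ {R L C} → KeyInC i C → KeyInC i (parR C L R)

  -- ≡K : smallest equivalence relation on 𝒫 generated by rule (i).
  -- (Rule (ii) is omitted: it only relates processes containing ∥_L, and the
  -- ≡K-classes of parallel-free processes are unaffected.)
  data _≡K_ : Proc → Proc → Set where
    rename : ∀ {C a ρ i j R} →
             Reachable (plug C (kpre a ρ i R)) →
             Reachable (plug C (kpre a ρ j R)) →
             ¬ SyncOnC a C →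
             ¬ KeyInC i C → ¬ KeyIn i R → ¬ KeyInC j C → ¬ KeyIn j R →
             plug C (kpre a ρ i R) ≡K plug C (kpre a ρ j R)
    ≡K-refl  : ∀ {R} → Reachable R → R ≡K R
    ≡K-sym   : ∀ {R S} → R ≡K S → S ≡K R
    ≡K-trans : ∀ {R S T} → R ≡K S → S ≡K T → R ≡K T

  -- CTMC transitions between ≡K-classes (classes given by representatives)
  FwdT : Proc → Act → Rate → Proc → Set
  FwdT X a ρ Y = Σ Proc λ S → Σ Proc λ S' → Σ Key λ i →
    X ≡K S × S —[ a , ρ , i ]→ S' × S' ≡K Y

  BwdT : Proc → Act → Rate → Proc → Set
  BwdT X a ν Y = Σ Proc λ S → Σ Proc λ S' → Σ Key λ i →
    X ≡K S × S ⇝[ a , ν , i ] S' × S' ≡K Y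

  data StateOf (R : Proc) : Proc → Set where
    init : ∀ {X} → R ≡K X → StateOf R X
    next : ∀ {X Y a ρ} → StateOf R X → FwdT X a ρ Y → StateOf R Y

  TreeLike : Proc → Set
  TreeLike R =
    (∀ X a ρ → StateOf R X → ¬ FwdT X a ρ R)
    × (∀ Z a ν → StateOf R Z → ¬ BwdT R a ν Z)
    × (∀ Y → StateOf R Y → ¬ (Y ≡K R) →
         Σ Proc λ P → Σ Act λ a → Σ Rate λ ρ₀ →
           StateOf R P × FwdT P a ρ₀ Y
           × (∀ P' a' ρ' → StateOf R P' → FwdT P' a' ρ' Y →
                P' ≡K P × a' ≡ a × ρ' ≡ ρ₀)
           × BwdT Y a (bar ρ₀) P
           × (∀ Z a' ν → StateOf R Z → BwdT Y a' ν Z →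
                Z ≡K P × a' ≡ a × ν ≡ bar ρ₀))

-- Without parallel composition every forward transition adds exactly one keyed
-- prefix and every backward one removes one, so the number of keys is a rank
-- that grows by one along births: the initial state, of minimal rank, has
-- neither a parent nor a death.  A forward transition determines its source and
-- label up to keys, and so does a backward one its target; and two reachable
-- parallel-free processes that agree up to keys are ≡K-equivalent, by renaming
-- their keys one prefix at a time through a fresh key.  Hence every other state
-- has a unique parent, and its unique death is the reversal of that birth.

module Submission where

open import Defs
open import Data.Nat using (ℕ; zero; suc; _+_; _≤_; _<_; _⊔_)
open import Data.Nat.Properties
  using (≤-trans; ≤-reflexive; n≤1+n; n<1+n; 1+n≰n; <⇒≱; m≤m⊔n; m≤n⊔m;
         m⊔n<o⇒m<o; m⊔n<o⇒n<o; suc-injective; +-suc; 0≢1+n)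
open import Data.Product using (Σ; ∃-syntax; _×_; _,_; proj₁; proj₂; swap)
open import Data.Sum using (_⊎_; inj₁; inj₂; [_,_])
import Data.Sum as Sum
open import Data.Empty using (⊥-elim)
open import Function using (_∘_)
open import Relation.Binary.PropositionalEquality
  using (_≡_; refl; sym; trans; cong; cong₂; subst; subst₂)
open import Relation.Nullary using (¬_)

module Properties (Rate : Set) (bar : Rate → Rate) (_·_ : Rate → Rate → Rate) where
  open RMPC Rate bar _·_

  infix 4 _≈_

  data _≈_ : Proc → Proc → Set where
    ≈-nil  : 𝟎 ≈ 𝟎
    ≈-pre  : ∀ {a ρ P Q} → P ≈ Q → pre a ρ P ≈ pre a ρ Q
    ≈-kpre : ∀ {a ρ i j R R'} → R ≈ R' → kpre a ρ i R ≈ kpre a ρ j R'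
    ≈-sum  : ∀ {R R' S S'} → R ≈ R' → S ≈ S' → R ⊕ S ≈ R' ⊕ S'
    ≈-par  : ∀ {R R' S S' L} → R ≈ R' → S ≈ S' → par R L S ≈ par R' L S'

  ≈-refl : ∀ {X} → X ≈ X
  ≈-refl {𝟎}            = ≈-nil
  ≈-refl {pre _ _ _}    = ≈-pre ≈-refl
  ≈-refl {kpre _ _ _ _} = ≈-kpre ≈-refl
  ≈-refl {_ ⊕ _}        = ≈-sum ≈-refl ≈-refl
  ≈-refl {par _ _ _}    = ≈-par ≈-refl ≈-refl

  ≈-sym : ∀ {X Y} → X ≈ Y → Y ≈ X
  ≈-sym ≈-nil       = ≈-nil
  ≈-sym (≈-pre p)   = ≈-pre (≈-sym p)
  ≈-sym (≈-kpre p)  = ≈-kpre (≈-sym p)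
  ≈-sym (≈-sum p q) = ≈-sum (≈-sym p) (≈-sym q)
  ≈-sym (≈-par p q) = ≈-par (≈-sym p) (≈-sym q)

  ≈-trans : ∀ {X Y Z} → X ≈ Y → Y ≈ Z → X ≈ Z
  ≈-trans ≈-nil       ≈-nil         = ≈-nil
  ≈-trans (≈-pre p)   (≈-pre q)     = ≈-pre (≈-trans p q)
  ≈-trans (≈-kpre p)  (≈-kpre q)    = ≈-kpre (≈-trans p q)
  ≈-trans (≈-sum p q) (≈-sum p' q') = ≈-sum (≈-trans p p') (≈-trans q q')
  ≈-trans (≈-par p q) (≈-par p' q') = ≈-par (≈-trans p p') (≈-trans q q')

  ≈-plug : ∀ C {X Y} → X ≈ Y → plug C X ≈ plug C Y
  ≈-plug ●               p = p
  ≈-plug (kpreC _ _ _ C) p = ≈-kpre (≈-plug C p)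
  ≈-plug (sumL _ C)      p = ≈-sum ≈-refl (≈-plug C p)
  ≈-plug (sumR C _)      p = ≈-sum (≈-plug C p) ≈-refl
  ≈-plug (parL _ _ C)    p = ≈-par ≈-refl (≈-plug C p)
  ≈-plug (parR C _ _)    p = ≈-par (≈-plug C p) ≈-refl

  std-≈ : ∀ {X Y} → Std X → X ≈ Y → Std Y
  std-≈ std-nil       ≈-nil       = std-nil
  std-≈ (std-pre s)   (≈-pre p)   = std-pre (std-≈ s p)
  std-≈ (std-sum s t) (≈-sum p q) = std-sum (std-≈ s p) (std-≈ t q)
  std-≈ (std-par s t) (≈-par p q) = std-par (std-≈ s p) (std-≈ t q)

  std-≈⇒≡ : ∀ {X Y} → Std X → X ≈ Y → X ≡ Y
  std-≈⇒≡ std-nil       ≈-nil       = refl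
  std-≈⇒≡ (std-pre s)   (≈-pre p)   = cong (pre _ _) (std-≈⇒≡ s p)
  std-≈⇒≡ (std-sum s t) (≈-sum p q) = cong₂ _⊕_ (std-≈⇒≡ s p) (std-≈⇒≡ t q)
  std-≈⇒≡ (std-par s t) (≈-par p q) = cong₂ (λ A B → par A _ B) (std-≈⇒≡ s p) (std-≈⇒≡ t q)

  noPar-≈ : ∀ {X Y} → NoPar X → X ≈ Y → NoPar Y
  noPar-≈ np-nil       ≈-nil       = np-nil
  noPar-≈ (np-pre n)   (≈-pre p)   = np-pre (noPar-≈ n p)
  noPar-≈ (np-kpre n)  (≈-kpre p)  = np-kpre (noPar-≈ n p)
  noPar-≈ (np-sum n m) (≈-sum p q) = np-sum (noPar-≈ n p) (noPar-≈ m q)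

  keyCount : Proc → ℕ
  keyCount 𝟎              = 0
  keyCount (pre _ _ P)    = keyCount P
  keyCount (kpre _ _ _ R) = suc (keyCount R)
  keyCount (R ⊕ S)        = keyCount R + keyCount S
  keyCount (par R _ S)    = keyCount R + keyCount S

  keyCount-≈ : ∀ {X Y} → X ≈ Y → keyCount X ≡ keyCount Y
  keyCount-≈ ≈-nil       = refl
  keyCount-≈ (≈-pre p)   = keyCount-≈ p
  keyCount-≈ (≈-kpre p)  = cong suc (keyCount-≈ p)
  keyCount-≈ (≈-sum p q) = cong₂ _+_ (keyCount-≈ p) (keyCount-≈ q)
  keyCount-≈ (≈-par p q) = cong₂ _+_ (keyCount-≈ p) (keyCount-≈ q)

  →-noPar : ∀ {X X' a ρ i} → NoPar X → X —[ a , ρ , i ]→ X' → NoPar X'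
  →-noPar (np-pre n)   (act1 _ _) = np-kpre n
  →-noPar (np-kpre n)  (act2 t _) = np-kpre (→-noPar n t)
  →-noPar (np-sum n m) (choˡ t _) = np-sum (→-noPar n t) m
  →-noPar (np-sum n m) (choʳ t _) = np-sum n (→-noPar m t)

  →-noPar⁻ : ∀ {X X' a ρ i} → X —[ a , ρ , i ]→ X' → NoPar X' → NoPar X
  →-noPar⁻ (act1 _ _) (np-kpre n)   = np-pre n
  →-noPar⁻ (act2 t _) (np-kpre n)   = np-kpre (→-noPar⁻ t n)
  →-noPar⁻ (choˡ t _) (np-sum n m)  = np-sum (→-noPar⁻ t n) m
  →-noPar⁻ (choʳ t _) (np-sum n m)  = np-sum n (→-noPar⁻ t m)

  →-keyCount : ∀ {X X' a ρ i} → NoPar X → X —[ a , ρ , i ]→ X' →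
               keyCount X' ≡ suc (keyCount X)
  →-keyCount (np-pre _)   (act1 _ _) = refl
  →-keyCount (np-kpre n)  (act2 t _) = cong suc (→-keyCount n t)
  →-keyCount (np-sum n _) (choˡ {S = S} t _) = cong (_+ keyCount S) (→-keyCount n t)
  →-keyCount (np-sum _ m) (choʳ {R = R} {S = S} t _) =
    trans (cong (keyCount R +_) (→-keyCount m t)) (+-suc (keyCount R) (keyCount S))

  ⇝-keyCount : ∀ {X X' a ν i} → NoPar X → X ⇝[ a , ν , i ] X' →
               keyCount X ≡ suc (keyCount X')
  ⇝-keyCount (np-kpre _)  (act1ʳ _)   = refl
  ⇝-keyCount (np-kpre n)  (act2ʳ t _) = cong suc (⇝-keyCount n t)
  ⇝-keyCount (np-sum n _) (choˡʳ {S = S} t _) = cong (_+ keyCount S) (⇝-keyCount n t)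
  ⇝-keyCount (np-sum _ m) (choʳʳ {R = R} {S' = S'} t _) =
    trans (cong (keyCount R +_) (⇝-keyCount m t)) (+-suc (keyCount R) (keyCount S'))

  →-target-¬std : ∀ {X X' a ρ i} → X —[ a , ρ , i ]→ X' → ¬ Std X'
  →-target-¬std (choˡ t _)   (std-sum s _) = →-target-¬std t s
  →-target-¬std (choʳ t _)   (std-sum _ s) = →-target-¬std t s
  →-target-¬std (parˡ t _ _) (std-par s _) = →-target-¬std t s
  →-target-¬std (parʳ t _ _) (std-par _ s) = →-target-¬std t s
  →-target-¬std (coo t _ _)  (std-par s _) = →-target-¬std t s

  std-¬⇝ : ∀ {X X' a ν i} → Std X → ¬ (X ⇝[ a , ν , i ] X')
  std-¬⇝ (std-sum s _) (choˡʳ t _)   = std-¬⇝ s t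
  std-¬⇝ (std-sum _ s) (choʳʳ t _)   = std-¬⇝ s t
  std-¬⇝ (std-par s _) (parˡʳ t _ _) = std-¬⇝ s t
  std-¬⇝ (std-par _ s) (parʳʳ t _ _) = std-¬⇝ s t
  std-¬⇝ (std-par s _) (cooʳ t _ _)  = std-¬⇝ s t

  →⇒⇝ : ∀ {X X' a ρ i} → NoPar X → X —[ a , ρ , i ]→ X' → X' ⇝[ a , bar ρ , i ] X
  →⇒⇝ _            (act1 _ s)  = act1ʳ s
  →⇒⇝ (np-kpre n)  (act2 t ne) = act2ʳ (→⇒⇝ n t) ne
  →⇒⇝ (np-sum n _) (choˡ t s)  = choˡʳ (→⇒⇝ n t) s
  →⇒⇝ (np-sum _ m) (choʳ t s)  = choʳʳ (→⇒⇝ m t) s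

  →-source-unique : ∀ {X X' Y Y' a b ρ μ i j} → NoPar X →
                    X —[ a , ρ , i ]→ X' → Y —[ b , μ , j ]→ Y' → X' ≈ Y' →
                    X ≈ Y × a ≡ b × ρ ≡ μ
  →-source-unique _ (act1 _ _) (act1 _ _) (≈-kpre p) = ≈-pre p , refl , refl
  →-source-unique _ (act1 _ s) (act2 t _) (≈-kpre p) = ⊥-elim (→-target-¬std t (std-≈ s p))
  →-source-unique _ (act2 t _) (act1 _ s) (≈-kpre p) = ⊥-elim (→-target-¬std t (std-≈ s (≈-sym p)))
  →-source-unique (np-kpre n) (act2 t _) (act2 t' _) (≈-kpre p)
    with →-source-unique n t t' p
  ... | q , refl , refl = ≈-kpre q , refl , refl
  →-source-unique (np-sum n _) (choˡ t _) (choˡ t' _) (≈-sum p q)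
    with →-source-unique n t t' p
  ... | r , refl , refl = ≈-sum r q , refl , refl
  →-source-unique _ (choˡ t _) (choʳ _ s) (≈-sum p _) = ⊥-elim (→-target-¬std t (std-≈ s (≈-sym p)))
  →-source-unique _ (choʳ _ s) (choˡ t _) (≈-sum p _) = ⊥-elim (→-target-¬std t (std-≈ s p))
  →-source-unique (np-sum _ m) (choʳ t _) (choʳ t' _) (≈-sum p q)
    with →-source-unique m t t' q
  ... | r , refl , refl = ≈-sum p r , refl , refl

  ⇝-deterministic : ∀ {X X' Y Y' a b ν ν' i j} → NoPar X →
                    X ⇝[ a , ν , i ] X' → Y ⇝[ b , ν' , j ] Y' → X ≈ Y →
                    X' ≈ Y' × a ≡ b × ν ≡ ν'
  ⇝-deterministic _ (act1ʳ _) (act1ʳ _) (≈-kpre p) = ≈-pre p , refl , refl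
  ⇝-deterministic _ (act1ʳ s) (act2ʳ u _) (≈-kpre p) = ⊥-elim (std-¬⇝ (std-≈ s p) u)
  ⇝-deterministic _ (act2ʳ u _) (act1ʳ s) (≈-kpre p) = ⊥-elim (std-¬⇝ (std-≈ s (≈-sym p)) u)
  ⇝-deterministic (np-kpre n) (act2ʳ u _) (act2ʳ u' _) (≈-kpre p)
    with ⇝-deterministic n u u' p
  ... | q , refl , refl = ≈-kpre q , refl , refl
  ⇝-deterministic (np-sum n _) (choˡʳ u _) (choˡʳ u' _) (≈-sum p q)
    with ⇝-deterministic n u u' p
  ... | r , refl , refl = ≈-sum r q , refl , refl
  ⇝-deterministic _ (choˡʳ u _) (choʳʳ _ s) (≈-sum p _) = ⊥-elim (std-¬⇝ (std-≈ s (≈-sym p)) u)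
  ⇝-deterministic _ (choʳʳ _ s) (choˡʳ u _) (≈-sum p _) = ⊥-elim (std-¬⇝ (std-≈ s p) u)
  ⇝-deterministic (np-sum _ m) (choʳʳ u _) (choʳʳ u' _) (≈-sum p q)
    with ⇝-deterministic m u u' q
  ... | r , refl , refl = ≈-sum p r , refl , refl

  ≡K⇒≈ : ∀ {X Y} → X ≡K Y → X ≈ Y
  ≡K⇒≈ (rename {C = C} _ _ _ _ _ _ _) = ≈-plug C (≈-kpre ≈-refl)
  ≡K⇒≈ (≡K-refl _)     = ≈-refl
  ≡K⇒≈ (≡K-sym e)      = ≈-sym (≡K⇒≈ e)
  ≡K⇒≈ (≡K-trans e f)  = ≈-trans (≡K⇒≈ e) (≡K⇒≈ f)

  ≡K⇒reachable : ∀ {X Y} → X ≡K Y → Reachable X × Reachable Y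
  ≡K⇒reachable (rename r r' _ _ _ _ _) = r , r'
  ≡K⇒reachable (≡K-refl r)    = r , r
  ≡K⇒reachable (≡K-sym e)     = swap (≡K⇒reachable e)
  ≡K⇒reachable (≡K-trans e f) = proj₁ (≡K⇒reachable e) , proj₂ (≡K⇒reachable f)

  std⇒¬KeyIn : ∀ {X k} → Std X → ¬ KeyIn k X
  std⇒¬KeyIn (std-pre s)   (k-pre q)  = std⇒¬KeyIn s q
  std⇒¬KeyIn (std-sum s _) (k-sumˡ q) = std⇒¬KeyIn s q
  std⇒¬KeyIn (std-sum _ s) (k-sumʳ q) = std⇒¬KeyIn s q
  std⇒¬KeyIn (std-par s _) (k-parˡ q) = std⇒¬KeyIn s q
  std⇒¬KeyIn (std-par _ s) (k-parʳ q) = std⇒¬KeyIn s q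

  →-KeyIn-target : ∀ {X X' a ρ j} → X —[ a , ρ , j ]→ X' → KeyIn j X'
  →-KeyIn-target (act1 _ _)   = k-here
  →-KeyIn-target (act2 t _)   = k-there (→-KeyIn-target t)
  →-KeyIn-target (choˡ t _)   = k-sumˡ (→-KeyIn-target t)
  →-KeyIn-target (choʳ t _)   = k-sumʳ (→-KeyIn-target t)
  →-KeyIn-target (parˡ t _ _) = k-parˡ (→-KeyIn-target t)
  →-KeyIn-target (parʳ t _ _) = k-parʳ (→-KeyIn-target t)
  →-KeyIn-target (coo t _ _)  = k-parˡ (→-KeyIn-target t)

  →-KeyIn : ∀ {X X' a ρ j k} → X —[ a , ρ , j ]→ X' → KeyIn k X → KeyIn k X'
  →-KeyIn (act1 _ s)   (k-pre q)   = ⊥-elim (std⇒¬KeyIn s q)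
  →-KeyIn (act2 _ _)   k-here      = k-here
  →-KeyIn (act2 t _)   (k-there q) = k-there (→-KeyIn t q)
  →-KeyIn (choˡ t _)   (k-sumˡ q)  = k-sumˡ (→-KeyIn t q)
  →-KeyIn (choˡ _ _)   (k-sumʳ q)  = k-sumʳ q
  →-KeyIn (choʳ _ _)   (k-sumˡ q)  = k-sumˡ q
  →-KeyIn (choʳ t _)   (k-sumʳ q)  = k-sumʳ (→-KeyIn t q)
  →-KeyIn (parˡ t _ _) (k-parˡ q)  = k-parˡ (→-KeyIn t q)
  →-KeyIn (parˡ _ _ _) (k-parʳ q)  = k-parʳ q
  →-KeyIn (parʳ _ _ _) (k-parˡ q)  = k-parˡ q
  →-KeyIn (parʳ t _ _) (k-parʳ q)  = k-parʳ (→-KeyIn t q)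
  →-KeyIn (coo t _ _)  (k-parˡ q)  = k-parˡ (→-KeyIn t q)
  →-KeyIn (coo _ u _)  (k-parʳ q)  = k-parʳ (→-KeyIn u q)

  →-KeyIn⁻ : ∀ {X X' a ρ j k} → X —[ a , ρ , j ]→ X' → KeyIn k X' → k ≡ j ⊎ KeyIn k X
  →-KeyIn⁻ (act1 _ _)   k-here      = inj₁ refl
  →-KeyIn⁻ (act1 _ s)   (k-there q) = ⊥-elim (std⇒¬KeyIn s q)
  →-KeyIn⁻ (act2 _ _)   k-here      = inj₂ k-here
  →-KeyIn⁻ (act2 t _)   (k-there q) = Sum.map₂ k-there (→-KeyIn⁻ t q)
  →-KeyIn⁻ (choˡ t _)   (k-sumˡ q)  = Sum.map₂ k-sumˡ (→-KeyIn⁻ t q)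
  →-KeyIn⁻ (choˡ _ _)   (k-sumʳ q)  = inj₂ (k-sumʳ q)
  →-KeyIn⁻ (choʳ _ _)   (k-sumˡ q)  = inj₂ (k-sumˡ q)
  →-KeyIn⁻ (choʳ t _)   (k-sumʳ q)  = Sum.map₂ k-sumʳ (→-KeyIn⁻ t q)
  →-KeyIn⁻ (parˡ t _ _) (k-parˡ q)  = Sum.map₂ k-parˡ (→-KeyIn⁻ t q)
  →-KeyIn⁻ (parˡ _ _ _) (k-parʳ q)  = inj₂ (k-parʳ q)
  →-KeyIn⁻ (parʳ _ _ _) (k-parˡ q)  = inj₂ (k-parˡ q)
  →-KeyIn⁻ (parʳ t _ _) (k-parʳ q)  = Sum.map₂ k-parʳ (→-KeyIn⁻ t q)
  →-KeyIn⁻ (coo t _ _)  (k-parˡ q)  = Sum.map₂ k-parˡ (→-KeyIn⁻ t q)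
  →-KeyIn⁻ (coo _ u _)  (k-parʳ q)  = Sum.map₂ k-parʳ (→-KeyIn⁻ u q)

  -- A syntactic characterisation of the reachable parallel-free processes: the
  -- keys on every chain of prefixes are distinct, and each choice has at most
  -- one summand that is not standard.
  data Wf : Proc → Set where
    wf-nil  : Wf 𝟎
    wf-pre  : ∀ {a ρ P} → Wf P → Std P → Wf (pre a ρ P)
    wf-kpre : ∀ {a ρ i R} → Wf R → ¬ KeyIn i R → Wf (kpre a ρ i R)
    wf-sumˡ : ∀ {R S} → Wf R → Wf S → Std S → Wf (R ⊕ S)
    wf-sumʳ : ∀ {R S} → Wf R → Wf S → Std R → Wf (R ⊕ S)

  wf⇒noPar : ∀ {X} → Wf X → NoPar X
  wf⇒noPar wf-nil           = np-nil
  wf⇒noPar (wf-pre w _)     = np-pre (wf⇒noPar w)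
  wf⇒noPar (wf-kpre w _)    = np-kpre (wf⇒noPar w)
  wf⇒noPar (wf-sumˡ w w' _) = np-sum (wf⇒noPar w) (wf⇒noPar w')
  wf⇒noPar (wf-sumʳ w w' _) = np-sum (wf⇒noPar w) (wf⇒noPar w')

  std-wf : ∀ {X} → Std X → NoPar X → Wf X
  std-wf std-nil       _            = wf-nil
  std-wf (std-pre s)   (np-pre n)   = wf-pre (std-wf s n) s
  std-wf (std-sum s t) (np-sum n m) = wf-sumˡ (std-wf s n) (std-wf t m) t

  →-wf : ∀ {X X' a ρ i} → Wf X → X —[ a , ρ , i ]→ X' → Wf X'
  →-wf (wf-pre w s)      (act1 _ _)  = wf-kpre w (std⇒¬KeyIn s)
  →-wf (wf-kpre w i∉R)   (act2 t ne) = wf-kpre (→-wf w t) ([ ne ∘ sym , i∉R ] ∘ →-KeyIn⁻ t)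
  →-wf (wf-sumˡ w w' s)  (choˡ t _)  = wf-sumˡ (→-wf w t) w' s
  →-wf (wf-sumʳ w w' _)  (choˡ t s)  = wf-sumˡ (→-wf w t) w' s
  →-wf (wf-sumˡ w w' _)  (choʳ t s)  = wf-sumʳ w (→-wf w' t) s
  →-wf (wf-sumʳ w w' s)  (choʳ t _)  = wf-sumʳ w (→-wf w' t) s

  reachable⇒wf : ∀ {X} → Reachable X → NoPar X → Wf X
  reachable⇒wf (fwd s)    n = std-wf s n
  reachable⇒wf (step r t) n = →-wf (reachable⇒wf r (→-noPar⁻ t n)) t

  HasWfPredecessor : Proc → Set
  HasWfPredecessor X = ∃[ X₀ ] ∃[ a ] ∃[ ρ ] ∃[ i ] (Wf X₀ × X₀ —[ a , ρ , i ]→ X)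

  wf⇒std⊎predecessor : ∀ {X} → Wf X → Std X ⊎ HasWfPredecessor X
  wf⇒std⊎predecessor wf-nil       = inj₁ std-nil
  wf⇒std⊎predecessor (wf-pre _ s) = inj₁ (std-pre s)
  wf⇒std⊎predecessor (wf-kpre {a} {ρ} {i} {R} w i∉R) with wf⇒std⊎predecessor w
  ... | inj₁ s = inj₂ (pre a ρ R , a , ρ , i , wf-pre w s , act1 i s)
  ... | inj₂ (R₀ , b , μ , j , w₀ , t) =
    inj₂ (kpre a ρ i R₀ , b , μ , j , wf-kpre w₀ (i∉R ∘ →-KeyIn t) ,
          act2 t λ { refl → i∉R (→-KeyIn-target t) })
  wf⇒std⊎predecessor (wf-sumˡ {S = S} w w' s) with wf⇒std⊎predecessor w
  ... | inj₁ r = inj₁ (std-sum r s)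
  ... | inj₂ (R₀ , b , μ , j , w₀ , t) = inj₂ (R₀ ⊕ S , b , μ , j , wf-sumˡ w₀ w' s , choˡ t s)
  wf⇒std⊎predecessor (wf-sumʳ {R = R} w w' r) with wf⇒std⊎predecessor w'
  ... | inj₁ s = inj₁ (std-sum r s)
  ... | inj₂ (S₀ , b , μ , j , w₀ , t) = inj₂ (R ⊕ S₀ , b , μ , j , wf-sumʳ w w₀ r , choʳ t r)

  wf⇒reachable : ∀ {X} → Wf X → Reachable X
  wf⇒reachable w = by-keyCount _ refl w
    where
      by-keyCount : ∀ n {X} → keyCount X ≡ n → Wf X → Reachable X
      by-keyCount n e w with wf⇒std⊎predecessor w
      by-keyCount _       _ _ | inj₁ s = fwd s
      by-keyCount zero    e _ | inj₂ (_ , _ , _ , _ , w₀ , t) =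
        ⊥-elim (0≢1+n (trans (sym e) (→-keyCount (wf⇒noPar w₀) t)))
      by-keyCount (suc n) e _ | inj₂ (_ , _ , _ , _ , w₀ , t) =
        step (by-keyCount n (suc-injective (trans (sym (→-keyCount (wf⇒noPar w₀) t)) e)) w₀) t

  _∘ᶜ_ : Ctx → Ctx → Ctx
  ●               ∘ᶜ D = D
  kpreC a ρ i C   ∘ᶜ D = kpreC a ρ i (C ∘ᶜ D)
  sumL R C        ∘ᶜ D = sumL R (C ∘ᶜ D)
  sumR C R        ∘ᶜ D = sumR (C ∘ᶜ D) R
  parL R L C      ∘ᶜ D = parL R L (C ∘ᶜ D)
  parR C L R      ∘ᶜ D = parR (C ∘ᶜ D) L R

  plug-∘ᶜ : ∀ C D X → plug (C ∘ᶜ D) X ≡ plug C (plug D X)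
  plug-∘ᶜ ●               D X = refl
  plug-∘ᶜ (kpreC a ρ i C) D X = cong (kpre a ρ i) (plug-∘ᶜ C D X)
  plug-∘ᶜ (sumL R C)      D X = cong (R ⊕_) (plug-∘ᶜ C D X)
  plug-∘ᶜ (sumR C R)      D X = cong (_⊕ R) (plug-∘ᶜ C D X)
  plug-∘ᶜ (parL R L C)    D X = cong (par R L) (plug-∘ᶜ C D X)
  plug-∘ᶜ (parR C L R)    D X = cong (λ Z → par Z L R) (plug-∘ᶜ C D X)

  KeyIn-plug : ∀ C {X k} → KeyIn k X → KeyIn k (plug C X)
  KeyIn-plug ●               q = q
  KeyIn-plug (kpreC _ _ _ C) q = k-there (KeyIn-plug C q)
  KeyIn-plug (sumL _ C)      q = k-sumʳ (KeyIn-plug C q)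
  KeyIn-plug (sumR C _)      q = k-sumˡ (KeyIn-plug C q)
  KeyIn-plug (parL _ _ C)    q = k-parʳ (KeyIn-plug C q)
  KeyIn-plug (parR C _ _)    q = k-parˡ (KeyIn-plug C q)

  KeyIn-plug-rekey : ∀ C {a ρ i k l R} → KeyIn l (plug C (kpre a ρ k R)) →
                     l ≡ k ⊎ KeyIn l (plug C (kpre a ρ i R))
  KeyIn-plug-rekey ●               k-here      = inj₁ refl
  KeyIn-plug-rekey ●               (k-there q) = inj₂ (k-there q)
  KeyIn-plug-rekey (kpreC _ _ _ _) k-here      = inj₂ k-here
  KeyIn-plug-rekey (kpreC _ _ _ C) (k-there q) = Sum.map₂ k-there (KeyIn-plug-rekey C q)
  KeyIn-plug-rekey (sumL _ _)      (k-sumˡ q)  = inj₂ (k-sumˡ q)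
  KeyIn-plug-rekey (sumL _ C)      (k-sumʳ q)  = Sum.map₂ k-sumʳ (KeyIn-plug-rekey C q)
  KeyIn-plug-rekey (sumR C _)      (k-sumˡ q)  = Sum.map₂ k-sumˡ (KeyIn-plug-rekey C q)
  KeyIn-plug-rekey (sumR _ _)      (k-sumʳ q)  = inj₂ (k-sumʳ q)
  KeyIn-plug-rekey (parL _ _ _)    (k-parˡ q)  = inj₂ (k-parˡ q)
  KeyIn-plug-rekey (parL _ _ C)    (k-parʳ q)  = Sum.map₂ k-parʳ (KeyIn-plug-rekey C q)
  KeyIn-plug-rekey (parR C _ _)    (k-parˡ q)  = Sum.map₂ k-parˡ (KeyIn-plug-rekey C q)
  KeyIn-plug-rekey (parR _ _ _)    (k-parʳ q)  = inj₂ (k-parʳ q)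

  std-plug⁻ : ∀ C {X} → Std (plug C X) → Std X
  std-plug⁻ ●               s             = s
  std-plug⁻ (sumL _ C)      (std-sum _ s) = std-plug⁻ C s
  std-plug⁻ (sumR C _)      (std-sum s _) = std-plug⁻ C s
  std-plug⁻ (parL _ _ C)    (std-par _ s) = std-plug⁻ C s
  std-plug⁻ (parR C _ _)    (std-par s _) = std-plug⁻ C s

  plug-kpre-¬std : ∀ C {a ρ i R} → ¬ Std (plug C (kpre a ρ i R))
  plug-kpre-¬std C s with std-plug⁻ C s
  ... | ()

  wf-plug⁻ : ∀ C {X} → Wf (plug C X) → Wf X
  wf-plug⁻ ●               w                = w
  wf-plug⁻ (kpreC _ _ _ C) (wf-kpre w _)    = wf-plug⁻ C w
  wf-plug⁻ (sumL _ C)      (wf-sumˡ _ w _)  = wf-plug⁻ C w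
  wf-plug⁻ (sumL _ C)      (wf-sumʳ _ w _)  = wf-plug⁻ C w
  wf-plug⁻ (sumR C _)      (wf-sumˡ w _ _)  = wf-plug⁻ C w
  wf-plug⁻ (sumR C _)      (wf-sumʳ w _ _)  = wf-plug⁻ C w

  wf-plug-kpre-¬KeyInC : ∀ C {a ρ i R} → Wf (plug C (kpre a ρ i R)) → ¬ KeyInC i C
  wf-plug-kpre-¬KeyInC (kpreC _ _ _ C) (wf-kpre _ l∉) kc-here      = l∉ (KeyIn-plug C k-here)
  wf-plug-kpre-¬KeyInC (kpreC _ _ _ C) (wf-kpre w _)  (kc-there q) = wf-plug-kpre-¬KeyInC C w q
  wf-plug-kpre-¬KeyInC (sumL _ C) (wf-sumˡ _ _ s) _              = plug-kpre-¬std C s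
  wf-plug-kpre-¬KeyInC (sumL _ _) (wf-sumʳ _ _ s) (kc-sumL-p q)  = std⇒¬KeyIn s q
  wf-plug-kpre-¬KeyInC (sumL _ C) (wf-sumʳ _ w _) (kc-sumL-c q)  = wf-plug-kpre-¬KeyInC C w q
  wf-plug-kpre-¬KeyInC (sumR C _) (wf-sumʳ _ _ s) _              = plug-kpre-¬std C s
  wf-plug-kpre-¬KeyInC (sumR _ _) (wf-sumˡ _ _ s) (kc-sumR-p q)  = std⇒¬KeyIn s q
  wf-plug-kpre-¬KeyInC (sumR C _) (wf-sumˡ w _ _) (kc-sumR-c q)  = wf-plug-kpre-¬KeyInC C w q

  wf-plug-rekey : ∀ C {a ρ i k R} → Wf (plug C (kpre a ρ i R)) →
                  ¬ KeyInC k C → ¬ KeyIn k R → Wf (plug C (kpre a ρ k R))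
  wf-plug-rekey ● (wf-kpre w _) _ k∉R = wf-kpre w k∉R
  wf-plug-rekey (kpreC _ _ _ C) (wf-kpre w l∉) k∉C k∉R =
    wf-kpre (wf-plug-rekey C w (k∉C ∘ kc-there) k∉R)
            ([ (λ { refl → k∉C kc-here }) , l∉ ] ∘ KeyIn-plug-rekey C)
  wf-plug-rekey (sumL _ C) (wf-sumˡ _ _ s) _ _ = ⊥-elim (plug-kpre-¬std C s)
  wf-plug-rekey (sumL _ C) (wf-sumʳ w w' s) k∉C k∉R =
    wf-sumʳ w (wf-plug-rekey C w' (k∉C ∘ kc-sumL-c) k∉R) s
  wf-plug-rekey (sumR C _) (wf-sumˡ w w' s) k∉C k∉R =
    wf-sumˡ (wf-plug-rekey C w (k∉C ∘ kc-sumR-c) k∉R) w' s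
  wf-plug-rekey (sumR C _) (wf-sumʳ _ _ s) _ _ = ⊥-elim (plug-kpre-¬std C s)

  noPar⇒¬SyncOn : ∀ {a X} → NoPar X → ¬ SyncOn a X
  noPar⇒¬SyncOn (np-pre n)   (s-pre q)  = noPar⇒¬SyncOn n q
  noPar⇒¬SyncOn (np-kpre n)  (s-kpre q) = noPar⇒¬SyncOn n q
  noPar⇒¬SyncOn (np-sum n _) (s-sumˡ q) = noPar⇒¬SyncOn n q
  noPar⇒¬SyncOn (np-sum _ m) (s-sumʳ q) = noPar⇒¬SyncOn m q

  noPar⇒¬SyncOnC : ∀ C {a X} → NoPar (plug C X) → ¬ SyncOnC a C
  noPar⇒¬SyncOnC (kpreC _ _ _ C) (np-kpre n)  (sc-kpre q)      = noPar⇒¬SyncOnC C n q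
  noPar⇒¬SyncOnC (sumL _ _)      (np-sum n _) (sc-sumL-proc q) = noPar⇒¬SyncOn n q
  noPar⇒¬SyncOnC (sumL _ C)      (np-sum _ m) (sc-sumL-ctx q)  = noPar⇒¬SyncOnC C m q
  noPar⇒¬SyncOnC (sumR _ _)      (np-sum _ m) (sc-sumR-proc q) = noPar⇒¬SyncOn m q
  noPar⇒¬SyncOnC (sumR C _)      (np-sum n _) (sc-sumR-ctx q)  = noPar⇒¬SyncOnC C n q

  rekey : ∀ C {a ρ i k R} → Wf (plug C (kpre a ρ i R)) → ¬ KeyInC k C → ¬ KeyIn k R →
          plug C (kpre a ρ i R) ≡K plug C (kpre a ρ k R)
  rekey C w k∉C k∉R with wf-plug⁻ C w
  ... | wf-kpre _ i∉R =
    rename (wf⇒reachable w) (wf⇒reachable (wf-plug-rekey C w k∉C k∉R))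
           (noPar⇒¬SyncOnC C (wf⇒noPar w)) (wf-plug-kpre-¬KeyInC C w) i∉R k∉C k∉R

  maxKey : Proc → ℕ
  maxKey 𝟎              = 0
  maxKey (pre _ _ P)    = maxKey P
  maxKey (kpre _ _ i R) = i ⊔ maxKey R
  maxKey (R ⊕ S)        = maxKey R ⊔ maxKey S
  maxKey (par R _ S)    = maxKey R ⊔ maxKey S

  maxKeyᶜ : Ctx → ℕ
  maxKeyᶜ ●               = 0
  maxKeyᶜ (kpreC _ _ i C) = i ⊔ maxKeyᶜ C
  maxKeyᶜ (sumL R C)      = maxKey R ⊔ maxKeyᶜ C
  maxKeyᶜ (sumR C R)      = maxKeyᶜ C ⊔ maxKey R
  maxKeyᶜ (parL R _ C)    = maxKey R ⊔ maxKeyᶜ C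
  maxKeyᶜ (parR C _ R)    = maxKeyᶜ C ⊔ maxKey R

  KeyIn⇒≤maxKey : ∀ {k X} → KeyIn k X → k ≤ maxKey X
  KeyIn⇒≤maxKey (k-pre q) = KeyIn⇒≤maxKey q
  KeyIn⇒≤maxKey {k} (k-here {R = R}) = m≤m⊔n k (maxKey R)
  KeyIn⇒≤maxKey (k-there {j = j} {R = R} q) = ≤-trans (KeyIn⇒≤maxKey q) (m≤n⊔m j (maxKey R))
  KeyIn⇒≤maxKey (k-sumˡ {R = R} {S} q) = ≤-trans (KeyIn⇒≤maxKey q) (m≤m⊔n (maxKey R) (maxKey S))
  KeyIn⇒≤maxKey (k-sumʳ {R = R} {S} q) = ≤-trans (KeyIn⇒≤maxKey q) (m≤n⊔m (maxKey R) (maxKey S))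
  KeyIn⇒≤maxKey (k-parˡ {R = R} {S} q) = ≤-trans (KeyIn⇒≤maxKey q) (m≤m⊔n (maxKey R) (maxKey S))
  KeyIn⇒≤maxKey (k-parʳ {R = R} {S} q) = ≤-trans (KeyIn⇒≤maxKey q) (m≤n⊔m (maxKey R) (maxKey S))

  KeyInC⇒≤maxKeyᶜ : ∀ {k C} → KeyInC k C → k ≤ maxKeyᶜ C
  KeyInC⇒≤maxKeyᶜ {k} (kc-here {C = C}) = m≤m⊔n k (maxKeyᶜ C)
  KeyInC⇒≤maxKeyᶜ (kc-there {j = j} {C} q) = ≤-trans (KeyInC⇒≤maxKeyᶜ q) (m≤n⊔m j (maxKeyᶜ C))
  KeyInC⇒≤maxKeyᶜ (kc-sumL-p {R} {C} q) = ≤-trans (KeyIn⇒≤maxKey q) (m≤m⊔n (maxKey R) (maxKeyᶜ C))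
  KeyInC⇒≤maxKeyᶜ (kc-sumL-c {R} {C} q) = ≤-trans (KeyInC⇒≤maxKeyᶜ q) (m≤n⊔m (maxKey R) (maxKeyᶜ C))
  KeyInC⇒≤maxKeyᶜ (kc-sumR-p {R} {C} q) = ≤-trans (KeyIn⇒≤maxKey q) (m≤n⊔m (maxKeyᶜ C) (maxKey R))
  KeyInC⇒≤maxKeyᶜ (kc-sumR-c {R} {C} q) = ≤-trans (KeyInC⇒≤maxKeyᶜ q) (m≤m⊔n (maxKeyᶜ C) (maxKey R))
  KeyInC⇒≤maxKeyᶜ (kc-parL-p {R} {_} {C} q) = ≤-trans (KeyIn⇒≤maxKey q) (m≤m⊔n (maxKey R) (maxKeyᶜ C))
  KeyInC⇒≤maxKeyᶜ (kc-parL-c {R} {_} {C} q) = ≤-trans (KeyInC⇒≤maxKeyᶜ q) (m≤n⊔m (maxKey R) (maxKeyᶜ C))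
  KeyInC⇒≤maxKeyᶜ (kc-parR-p {R} {_} {C} q) = ≤-trans (KeyIn⇒≤maxKey q) (m≤n⊔m (maxKeyᶜ C) (maxKey R))
  KeyInC⇒≤maxKeyᶜ (kc-parR-c {R} {_} {C} q) = ≤-trans (KeyInC⇒≤maxKeyᶜ q) (m≤m⊔n (maxKeyᶜ C) (maxKey R))

  >maxKey⇒¬KeyIn : ∀ {k X} → maxKey X < k → ¬ KeyIn k X
  >maxKey⇒¬KeyIn lt = <⇒≱ lt ∘ KeyIn⇒≤maxKey

  >maxKeyᶜ⇒¬KeyInC : ∀ {k C} → maxKeyᶜ C < k → ¬ KeyInC k C
  >maxKeyᶜ⇒¬KeyInC lt = <⇒≱ lt ∘ KeyInC⇒≤maxKeyᶜ

  plug-≈⇒≡K : ∀ C {X Y} → X ≈ Y → Wf (plug C X) → Wf (plug C Y) → plug C X ≡K plug C Y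
  plug-∘ᶜ-≈⇒≡K : ∀ C D {X Y} → X ≈ Y → Wf (plug C (plug D X)) → Wf (plug C (plug D Y)) →
                 plug C (plug D X) ≡K plug C (plug D Y)

  plug-≈⇒≡K _ ≈-nil _ w' = ≡K-refl (wf⇒reachable w')
  plug-≈⇒≡K C (≈-pre p) w w' with wf-plug⁻ C w
  ... | wf-pre _ s with std-≈⇒≡ s p
  ... | refl = ≡K-refl (wf⇒reachable w')
  plug-≈⇒≡K C (≈-par _ _) w _ with wf-plug⁻ C w
  ... | ()
  plug-≈⇒≡K C (≈-sum {R} {R'} {S} {S'} p q) w w' with wf-plug⁻ C w
  ... | wf-sumˡ _ _ s rewrite std-≈⇒≡ s q = plug-∘ᶜ-≈⇒≡K C (sumR ● S') p w w'
  ... | wf-sumʳ _ _ r rewrite std-≈⇒≡ r p = plug-∘ᶜ-≈⇒≡K C (sumL R' ●) q w w'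
  -- Rename the outer key i to a fresh k, relate the bodies under k, then rename k to j.
  plug-≈⇒≡K C (≈-kpre {a} {ρ} {i} {j} {R} {R'} p) w w' =
    ≡K-trans (rekey C w k∉C k∉R)
      (≡K-trans (plug-∘ᶜ-≈⇒≡K C (kpreC a ρ k ●) p
                  (wf-plug-rekey C w k∉C k∉R) (wf-plug-rekey C w' k∉C k∉R'))
                (≡K-sym (rekey C w' k∉C k∉R')))
    where
      Mᶜ = maxKeyᶜ C
      M = Mᶜ ⊔ maxKey R ⊔ maxKey R'
      k = suc M
      k∉C : ¬ KeyInC k C
      k∉C = >maxKeyᶜ⇒¬KeyInC (m⊔n<o⇒m<o Mᶜ (maxKey R) (m⊔n<o⇒m<o (Mᶜ ⊔ maxKey R) (maxKey R') (n<1+n M)))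
      k∉R : ¬ KeyIn k R
      k∉R = >maxKey⇒¬KeyIn (m⊔n<o⇒n<o Mᶜ (maxKey R) (m⊔n<o⇒m<o (Mᶜ ⊔ maxKey R) (maxKey R') (n<1+n M)))
      k∉R' : ¬ KeyIn k R'
      k∉R' = >maxKey⇒¬KeyIn (m⊔n<o⇒n<o (Mᶜ ⊔ maxKey R) (maxKey R') (n<1+n M))

  plug-∘ᶜ-≈⇒≡K C D {X} {Y} p w w' =
    subst₂ _≡K_ (plug-∘ᶜ C D X) (plug-∘ᶜ C D Y)
      (plug-≈⇒≡K (C ∘ᶜ D) p (subst Wf (sym (plug-∘ᶜ C D X)) w) (subst Wf (sym (plug-∘ᶜ C D Y)) w'))

  ≈⇒≡K : ∀ {X Y} → X ≈ Y → Wf X → Wf Y → X ≡K Y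
  ≈⇒≡K = plug-≈⇒≡K ●

  birth-keyCount : ∀ {X Y a ρ} → NoPar X → FwdT X a ρ Y → keyCount Y ≡ suc (keyCount X)
  birth-keyCount n (_ , _ , _ , e , t , e') =
    trans (sym (keyCount-≈ (≡K⇒≈ e')))
      (trans (→-keyCount (noPar-≈ n (≡K⇒≈ e)) t) (cong suc (sym (keyCount-≈ (≡K⇒≈ e)))))

  death-keyCount : ∀ {X Z a ν} → NoPar X → BwdT X a ν Z → keyCount X ≡ suc (keyCount Z)
  death-keyCount n (_ , _ , _ , e , t , e') =
    trans (keyCount-≈ (≡K⇒≈ e))
      (trans (⇝-keyCount (noPar-≈ n (≡K⇒≈ e)) t) (cong suc (keyCount-≈ (≡K⇒≈ e'))))

  birth-wf : ∀ {X Y a ρ} → Wf X → FwdT X a ρ Y → Wf Y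
  birth-wf w (_ , _ , _ , e , t , e') =
    reachable⇒wf (proj₂ (≡K⇒reachable e'))
      (noPar-≈ (→-noPar (noPar-≈ (wf⇒noPar w) (≡K⇒≈ e)) t) (≡K⇒≈ e'))

  birth-reversible : ∀ {X Y a ρ} → NoPar X → FwdT X a ρ Y → BwdT Y a (bar ρ) X
  birth-reversible n (S , S' , i , e , t , e') =
    S' , S , i , ≡K-sym e' , →⇒⇝ (noPar-≈ n (≡K⇒≈ e)) t , ≡K-sym e

  birth-source-unique : ∀ {X X' Y a a' ρ ρ'} → Wf X' → Wf X →
                        FwdT X' a' ρ' Y → FwdT X a ρ Y → X' ≡K X × a' ≡ a × ρ' ≡ ρ
  birth-source-unique w' w (_ , _ , _ , f , t' , f') (_ , _ , _ , e , t , e')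
    with →-source-unique (noPar-≈ (wf⇒noPar w') (≡K⇒≈ f)) t' t (≈-trans (≡K⇒≈ f') (≈-sym (≡K⇒≈ e')))
  ... | S'≈S , refl , refl =
    ≈⇒≡K (≈-trans (≡K⇒≈ f) (≈-trans S'≈S (≈-sym (≡K⇒≈ e)))) w' w , refl , refl

  death-target-unique : ∀ {X Y Z a a' ρ ν} → Wf X → Wf Z →
                        FwdT X a ρ Y → BwdT Y a' ν Z → Z ≡K X × a' ≡ a × ν ≡ bar ρ
  death-target-unique w w' (_ , _ , _ , e , t , e') (_ , _ , _ , f , u , f')
    with noPar-≈ (wf⇒noPar w) (≡K⇒≈ e)
  ... | n with ⇝-deterministic (→-noPar n t) (→⇒⇝ n t) u (≈-trans (≡K⇒≈ e') (≡K⇒≈ f))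
  ... | S≈T' , refl , refl =
    ≈⇒≡K (≈-sym (≈-trans (≡K⇒≈ e) (≈-trans S≈T' (≡K⇒≈ f')))) w' w , refl , refl

  state-wf : ∀ {R X} → NoPar R → StateOf R X → Wf X
  state-wf n (init e)   = reachable⇒wf (proj₂ (≡K⇒reachable e)) (noPar-≈ n (≡K⇒≈ e))
  state-wf n (next s b) = birth-wf (state-wf n s) b

  state-keyCount : ∀ {R X} → NoPar R → StateOf R X → keyCount R ≤ keyCount X
  state-keyCount _ (init e) = ≤-reflexive (keyCount-≈ (≡K⇒≈ e))
  state-keyCount n (next s b) =
    subst (_ ≤_) (sym (birth-keyCount (wf⇒noPar (state-wf n s)) b)) (≤-trans (state-keyCount n s) (n≤1+n _))

  initial-no-birth : ∀ {R} → NoPar R → ∀ X a ρ → StateOf R X → ¬ FwdT X a ρ R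
  initial-no-birth n X _ _ s b =
    1+n≰n (subst (_≤ keyCount X) (birth-keyCount (wf⇒noPar (state-wf n s)) b) (state-keyCount n s))

  initial-no-death : ∀ {R} → NoPar R → ∀ Z a ν → StateOf R Z → ¬ BwdT R a ν Z
  initial-no-death n Z _ _ s d =
    1+n≰n (subst (_≤ keyCount Z) (death-keyCount n d) (state-keyCount n s))

  unique-parent : ∀ {R} → NoPar R → ∀ Y → StateOf R Y → ¬ (Y ≡K R) →
    Σ Proc λ P → Σ Act λ a → Σ Rate λ ρ₀ →
      StateOf R P × FwdT P a ρ₀ Y
      × (∀ P' a' ρ' → StateOf R P' → FwdT P' a' ρ' Y → P' ≡K P × a' ≡ a × ρ' ≡ ρ₀)
      × BwdT Y a (bar ρ₀) P
      × (∀ Z a' ν → StateOf R Z → BwdT Y a' ν Z → Z ≡K P × a' ≡ a × ν ≡ bar ρ₀)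
  unique-parent _ _ (init e) Y≢R = ⊥-elim (Y≢R (≡K-sym e))
  unique-parent n _ (next {X} {_} {a} {ρ} s b) _ =
    X , a , ρ , s , b
    , (λ _ _ _ s' b' → birth-source-unique (state-wf n s') (state-wf n s) b' b)
    , birth-reversible (wf⇒noPar (state-wf n s)) b
    , (λ _ _ _ s' d → death-target-unique (state-wf n s) (state-wf n s') b d)

lemma4p15 : (Rate : Set) (bar : Rate → Rate) (_·_ : Rate → Rate → Rate)
            (R : RMPC.Proc Rate bar _·_) →
            RMPC.Reachable Rate bar _·_ R → RMPC.NoPar Rate bar _·_ R →
            RMPC.TreeLike Rate bar _·_ R
lemma4p15 Rate bar _·_ R _ n = initial-no-birth n , initial-no-death n , unique-parent n
  where open Properties Rate bar _·_
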